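{- Let $e,e',\hat e$ be events of a branching process of a parallel composition $\mathbf{A}=\mathcal{A}_1\parallel\cdots\parallel\mathcal{A}_n$ of labelled transition systems. If $e'\ll e$ and $\hat e$ is concurrent with both $e'$ and $e$, then $([e]\setminus[e'])\cap[\hat e]=\emptyset$.
   Context: LTS $\mathcal{A}_j=(\Sigma_j,S_j,T_j,\lambda_j,s^0_j)$ with states $S_j$, transitions $T_j\subseteq S_j\times S_j$, labelling $\lambda_j:T_j\to\Sigma_j$, initial state $s^0_j$. Global transitions of $\mathbf{A}$ are tuples $\mathbf{t}=(t_1,\dots,t_n)\in\prod_j(T_j\cup\{\star\})$, not all $\star$, such that for some action $a$ and every $j$: $t_j$ is an $a$-labelled transition of $T_j$ if $a\in\Sigma_j$, else $t_j=\star$; $\mathcal{A}_j$ participates in $\mathbf{t}$ if $t_j\neq\star$. Branching processes of $\mathbf{A}$ are Petri nets (places = conditions, transitions = events; $\bullet x$, $x\bullet$ input/output sets; firing $t$ at marking $M\supseteq\bullet t$ gives $(M\setminus\bullet t)\cup t\bullet$) defined inductively: (1) the net with conditions $b^0_1,\dots,b^0_n$ labelled $s^0_1,\dots,s^0_n$, no events, initial marking $\{b^0_1,\dots,b^0_n\}$; (2) if $\mathcal{N}$ is one, $M'$ a reachable marking, $\mathbf{t}$ a global transition such that for each participating $j$ with $t_j=(s_j,s'_j)$ some condition of $M'$ is labelled $s_j$, $M$ the set of these conditions, and no event labelled $\mathbf{t}$ has input set $M$, then adding a new event $e$ labelled $\mathbf{t}$ with $\bullet e=M$ and new output conditions labelled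 $s'_j$ for each participating $j$ yields a branching process; arbitrary branching processes are (suitably renamed) countable unions of finite ones. For nodes $x,y$: $x<y$ if there is a nonempty directed path from $x$ to $y$; $x\#y$ (conflict) if some condition $z\neq x,y$ has paths to both $x$ and $y$ leaving $z$ by different arcs; $x$ and $y$ are concurrent if neither $x\le y$, nor $y\le x$, nor $x\#y$. The past of $e$ is $[e]=\{e':e'\le e\}$ and $M(e)$ is the marking reached by any occurrence sequence firing exactly the events of $[e]$. Strong causality: $e'\ll e$ if $e'<e$ and $b'<b$ for every $b\in M(e)\setminus M(e')$ and every $b'\in M(e')\setminus M(e)$. -}

module Defs where

open import Data.Nat using (ℕ; _<_)
open import Data.Fin using (Fin)
open import Data.Maybe using (Maybe; just; nothing)
open import Data.Product using (Σ; ∃; ∃₂; _×_; _,_; proj₁; proj₂)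
open import Data.Sum using (_⊎_)
open import Data.Unit using (⊤)
open import Data.List using (List; []; _∷_)
open import Data.List.Relation.Unary.All using (All)
open import Data.List.Membership.Propositional using (_∈_)
open import Relation.Nullary using (¬_)
open import Relation.Binary.PropositionalEquality using (_≡_; _≢_)
open import Relation.Binary.Construct.Closure.Transitive using (TransClosure)
open import Relation.Binary.Construct.Closure.ReflexiveTransitive using (Star)

-- Labelled transition systems over a common universe of action names.
-- Σ_j ⊆ Act is the alphabet, T ⊆ S × S (a proof-irrelevant relation),
-- λ : T → Σ_j.

record LTS (Act : Set) : Set₁ where
  field
    Alph       : Act → Set
    State      : Set
    Trans      : State → State → Set
    Trans-prop : ∀ {s s'} (p q : Trans s s') → p ≡ q
    label      : ∀ {s s'} → Trans s s' → Act
    label∈Alph : ∀ {s s'} (t : Trans s s') → Alph (label t)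
    init       : State

open LTS public

module _ {Act : Set} {n : ℕ} (A : Fin n → LTS Act) where

  -- candidate global transitions: component j is ⋆ (nothing) or a pair (s_j , s'_j)
  GTrans : Set
  GTrans = (j : Fin n) → Maybe (State (A j) × State (A j))

  Participates : GTrans → Fin n → Set
  Participates t j = ∃ λ p → t j ≡ just p

  IsGlobal : GTrans → Set
  IsGlobal t =
    (¬ (∀ j → t j ≡ nothing)) ×
    (∃ λ a → ∀ j →
       (Alph (A j) a → ∃₂ λ s s' → t j ≡ just (s , s') ×
                         Σ (Trans (A j) s s') (λ tr → label (A j) tr ≡ a)) ×
       (¬ Alph (A j) a → t j ≡ nothing))

  -- Conditions: (j , nothing) is the initial condition b⁰_j;
  -- (j , just k) is the output condition of event k for component j.
  Cond : Set
  Cond = Fin n × Maybe ℕ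

  -- Raw data of a (possibly infinite) net built by the inductive rule:
  -- events are the natural numbers k with D k, numbered in order of addition.
  record PreBP : Set₁ where
    field
      D   : ℕ → Set
      lab : ℕ → GTrans
      pre : ℕ → Fin n → Maybe ℕ   -- producer of the input condition of component j

  data Node : Set where
    ev : ℕ → Node
    cd : Cond → Node

  module _ (P : PreBP) where
    open PreBP P

    InPre : Cond → ℕ → Set
    InPre (j , p) e = Participates (lab e) j × pre e j ≡ p

    InPost : Cond → ℕ → Set
    InPost (j , p) e = Participates (lab e) j × p ≡ just e

    CondLab : (b : Cond) → State (A (proj₁ b)) → Set
    CondLab (j , nothing) s = s ≡ init (A j)
    CondLab (j , just k)  s = ∃ λ s₀ → lab k j ≡ just (s₀ , s)

    Marking : Set₁
    Marking = Cond → Set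

    M₀ : Marking
    M₀ (j , p) = p ≡ nothing

    fire : ℕ → Marking → Marking
    fire e M b = (M b × ¬ InPre b e) ⊎ InPost b e

    Fireable : List ℕ → Marking → Set
    Fireable []      M = ⊤
    Fireable (e ∷ σ) M = D e × (∀ b → InPre b e → M b) × Fireable σ (fire e M)

    After : List ℕ → Marking → Marking
    After []      M = M
    After (e ∷ σ) M = After σ (fire e M)

    data Arc : Node → Node → Set where
      pre-arc  : ∀ {b e} → D e → InPre b e → Arc (cd b) (ev e)
      post-arc : ∀ {e b} → D e → InPost b e → Arc (ev e) (cd b)

    _≺_ : Node → Node → Set
    x ≺ y = TransClosure Arc x y

    _≼_ : Node → Node → Set
    x ≼ y = x ≡ y ⊎ x ≺ y

    _#_ : Node → Node → Set
    x # y = ∃ λ b → ∃₂ λ e₁ e₂ →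
      cd b ≢ x × cd b ≢ y × e₁ ≢ e₂ ×
      Arc (cd b) (ev e₁) × Arc (cd b) (ev e₂) ×
      Star Arc (ev e₁) x × Star Arc (ev e₂) y

    Concurrent : Node → Node → Set
    Concurrent x y = ¬ (x ≼ y) × ¬ (y ≼ x) × ¬ (x # y)

    InMark : ℕ → Cond → Set
    InMark e b = ∃ λ σ → Fireable σ M₀ ×
      (∀ x → (x ∈ σ → ev x ≼ ev e) × (ev x ≼ ev e → x ∈ σ)) ×
      After σ M₀ b

    StrongCause : ℕ → ℕ → Set
    StrongCause e' e = (ev e' ≺ ev e) ×
      (∀ b b' → InMark e b → ¬ InMark e' b → InMark e' b' → ¬ InMark e b' →
         cd b' ≺ cd b)

    -- P is a branching process of A (built by the inductive rule, possibly
    -- as the union of an infinite chain of finite ones)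
    record IsBranchingProcess : Set where
      field
        D-closed  : ∀ {k k'} → k' < k → D k → D k'
        lab-glob  : ∀ {k} → D k → IsGlobal (lab k)
        pre-label : ∀ {k} → D k → ∀ j s s' → lab k j ≡ just (s , s') →
                      CondLab (j , pre k j) s
        pre-reach : ∀ {k} → D k → ∃ λ σ → All (_< k) σ × Fireable σ M₀ ×
                      (∀ b → InPre b k → After σ M₀ b)
        fresh     : ∀ {k k'} → D k → k' < k →
                      ¬ ((∀ j → lab k' j ≡ lab k j) ×
                         (∀ b → (InPre b k' → InPre b k) × (InPre b k → InPre b k')))

-- Suppose x ∈ [e] ∖ [e'] and x ≤ ê. Walking along a path from x to ê, which ends outside [e], we meet
-- an arc pair z → c → z' with z ∈ [e] ∖ [e'] and z' ∉ [e]. No event of [e] consumes c (z' does not, and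
-- any other consumer would put e in conflict with ê), so c ∈ M(e) ∖ M(e'). Let d be the first condition
-- on a path from e' to e; then d ∈ M(e') ∖ M(e), and e' ≪ e gives d < c, whence e' < c < z' ≤ ê,
-- contradicting e' ∥ ê. The markings M(e) are realised by listing [e] in increasing order of event
-- index, which is a topological order; since [e] is not decidable, this list (and hence the whole
-- argument) lives under a double negation, which is harmless as the goal is a negation.
module Submission where

open import Defs
open import Data.Nat using (ℕ; zero; suc; _<_; _≤_; s≤s; _≟_)
open import Data.Nat.Properties
  using (<-irrefl; <-asym; <-trans; ≤-refl; <⇒≤; <⇒≢; n<1+n; m<n⇒m<1+n; m<1+n⇒m<n∨m≡n)
open import Data.Nat.Induction using (<-wellFounded)
open import Induction.WellFounded using (Acc; acc)
open import Data.Fin using (Fin)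
open import Data.Maybe using (just; nothing)
open import Data.Maybe.Properties using (just-injective)
open import Data.Product using (∃; ∃₂; _×_; _,_; proj₁; proj₂)
import Data.Product as Product
open import Data.Sum using (_⊎_; inj₁; inj₂)
open import Data.Unit using (tt)
open import Data.Empty using (⊥; ⊥-elim)
open import Data.List using (List; []; _∷_; _++_)
open import Data.List.Properties using (++-assoc)
open import Data.List.Relation.Unary.All as All using (All; []; _∷_)
open import Data.List.Relation.Unary.Any using (here; there)
open import Data.List.Relation.Unary.AllPairs using (AllPairs; []; _∷_)
import Data.List.Relation.Unary.AllPairs.Properties as AllPairs
open import Data.List.Membership.Propositional using (_∈_; _∉_)
open import Data.List.Membership.Propositional.Properties using (∈-∃++; ∈-++⁻; ∈-++⁺ˡ; ∈-++⁺ʳ)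
open import Function using (_∘_; case_of_)
open import Relation.Nullary using (¬_; yes; no)
open import Relation.Nullary.Decidable.Core using (¬¬-excluded-middle)
open import Relation.Binary.PropositionalEquality using (_≡_; _≢_; refl; sym; trans; cong; subst)
open import Relation.Binary.Construct.Closure.Transitive using ([_]; _∷_) renaming (_++_ to _++⁺_)
open import Relation.Binary.Construct.Closure.ReflexiveTransitive using (Star; ε; _◅_)

sorted-before : ∀ γ {k δ y} → AllPairs _<_ (γ ++ k ∷ δ) → y ∈ γ → y < k
sorted-before (_ ∷ γ) (x<rest ∷ _) (here refl) = All.lookup x<rest (∈-++⁺ʳ γ (here refl))
sorted-before (_ ∷ γ) (_ ∷ sorted) (there y∈γ) = sorted-before γ sorted y∈γ

sorted-after : ∀ γ {k δ} → AllPairs _<_ (γ ++ k ∷ δ) → All (k <_) δ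
sorted-after []      (k<δ ∷ _)  = k<δ
sorted-after (_ ∷ γ) (_ ∷ sorted) = sorted-after γ sorted

sorted-below : ∀ γ {k δ y} → AllPairs _<_ (γ ++ k ∷ δ) → y ∈ γ ++ k ∷ δ → y < k → y ∈ γ
sorted-below γ sorted y∈ y<k with ∈-++⁻ γ y∈
... | inj₁ y∈γ         = y∈γ
... | inj₂ (here refl) = ⊥-elim (<-irrefl refl y<k)
... | inj₂ (there y∈δ) = ⊥-elim (<-asym y<k (All.lookup (sorted-after γ sorted) y∈δ))

regroup : ∀ {a} {A : Set a} (α₁ α₂ β₁ β₂ : List A) {p} →
          (α₁ ++ p ∷ α₂) ++ β₁ ++ p ∷ β₂ ≡ α₁ ++ p ∷ (α₂ ++ β₁) ++ p ∷ β₂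
regroup α₁ α₂ β₁ β₂ {p} =
  trans (++-assoc α₁ (p ∷ α₂) _) (cong (λ σ → α₁ ++ p ∷ σ) (sym (++-assoc α₂ β₁ _)))

Enumerates : (ℕ → Set) → ℕ → List ℕ → Set
Enumerates Q m τ = AllPairs _<_ τ × (∀ {x} → x ∈ τ → x < m × Q x) × (∀ {x} → x < m → Q x → x ∈ τ)

module _ {Q : ℕ → Set} {m : ℕ} {τ : List ℕ} where

  enumerates-with : Enumerates Q m τ → Q m → Enumerates Q (suc m) (τ ++ m ∷ [])
  enumerates-with (sorted , sound , complete) qm = sorted′ , sound′ , complete′
    where
    sorted′ : AllPairs _<_ (τ ++ m ∷ [])
    sorted′ = AllPairs.++⁺ sorted ([] ∷ []) (All.tabulate λ x∈τ → proj₁ (sound x∈τ) ∷ [])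
    sound′ : ∀ {x} → x ∈ τ ++ m ∷ [] → x < suc m × Q x
    sound′ x∈ with ∈-++⁻ τ x∈
    ... | inj₁ x∈τ         = Product.map₁ m<n⇒m<1+n (sound x∈τ)
    ... | inj₂ (here refl) = n<1+n m , qm
    complete′ : ∀ {x} → x < suc m → Q x → x ∈ τ ++ m ∷ []
    complete′ x<1+m qx with m<1+n⇒m<n∨m≡n x<1+m
    ... | inj₁ x<m  = ∈-++⁺ˡ (complete x<m qx)
    ... | inj₂ refl = ∈-++⁺ʳ τ (here refl)

  enumerates-without : Enumerates Q m τ → ¬ Q m → Enumerates Q (suc m) τ
  enumerates-without (sorted , sound , complete) ¬qm = sorted , Product.map₁ m<n⇒m<1+n ∘ sound , complete′
    where
    complete′ : ∀ {x} → x < suc m → Q x → x ∈ τ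
    complete′ x<1+m qx with m<1+n⇒m<n∨m≡n x<1+m
    ... | inj₁ x<m  = complete x<m qx
    ... | inj₂ refl = ⊥-elim (¬qm qx)

¬¬-enumeration : ∀ (Q : ℕ → Set) m → ¬ ¬ ∃ (Enumerates Q m)
¬¬-enumeration Q zero    k = k ([] , [] , (λ ()) , (λ ()))
¬¬-enumeration Q (suc m) k = ¬¬-enumeration Q m λ (τ , enum) → ¬¬-excluded-middle λ where
  (yes qm)  → k (τ ++ m ∷ [] , enumerates-with enum qm)
  (no ¬qm) → k (τ , enumerates-without enum ¬qm)

module BranchingProcess {Act : Set} {n : ℕ} (A : Fin n → LTS Act) (P : PreBP A)
                        (BP : IsBranchingProcess A P) where
  open PreBP P
  open IsBranchingProcess BP

  infix 4 _⟶_ _⊏_ _⊑_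

  _⟶_ _⊏_ _⊑_ : Node A → Node A → Set
  _⟶_ = Arc A P
  _⊏_ = _≺_ A P
  _⊑_ = _≼_ A P

  Pre Post : Cond A → ℕ → Set
  Pre  = InPre A P
  Post = InPost A P

  M⁰ : Marking A P
  M⁰ = M₀ A P

  Fires : List ℕ → Marking A P → Set
  Fires = Fireable A P

  after : List ℕ → Marking A P → Marking A P
  after = After A P

  ⊑-trans : ∀ {x y z} → x ⊑ y → y ⊑ z → x ⊑ z
  ⊑-trans (inj₁ refl) y⊑z         = y⊑z
  ⊑-trans (inj₂ x⊏y)  (inj₁ refl) = inj₂ x⊏y
  ⊑-trans (inj₂ x⊏y)  (inj₂ y⊏z)  = inj₂ (x⊏y ++⁺ y⊏z)

  ⊑⇒⋆ : ∀ {x y} → x ⊑ y → Star _⟶_ x y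
  ⊑⇒⋆ (inj₁ refl) = ε
  ⊑⇒⋆ (inj₂ x⊏y) = go x⊏y
    where
    go : ∀ {x y} → x ⊏ y → Star _⟶_ x y
    go [ x→y ]     = x→y ◅ ε
    go (x→z ∷ z⊏y) = x→z ◅ go z⊏y

  ⊏-◅ : ∀ {x y z} → x ⟶ y → Star _⟶_ y z → x ⊏ z
  ⊏-◅ x→y ε             = [ x→y ]
  ⊏-◅ x→y (y→w ◅ w⋆z) = x→y ∷ ⊏-◅ y→w w⋆z

  ⊏-via : ∀ {x b y z} → x ⟶ b → b ⟶ y → y ⊑ z → x ⊏ z
  ⊏-via x→b b→y y⊑z = x→b ∷ ⊏-◅ b→y (⊑⇒⋆ y⊑z)

  ⊏-uncons : ∀ {x y} → ev x ⊏ ev y → ∃₂ λ b z → ev x ⟶ cd b × cd b ⟶ ev z × ev z ⊑ ev y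
  ⊏-uncons [ () ]
  ⊏-uncons (x→b@(post-arc _ _) ∷ [ b→y@(pre-arc _ _) ])   = _ , _ , x→b , b→y , inj₁ refl
  ⊏-uncons (x→b@(post-arc _ _) ∷ b→z@(pre-arc _ _) ∷ z⊏y) = _ , _ , x→b , b→z , inj₂ z⊏y

  ⊏⇒D : ∀ {x y} → ev x ⊏ ev y → D x
  ⊏⇒D [ () ]
  ⊏⇒D (post-arc dx _ ∷ _) = dx

  ⊑⇒D : ∀ {x y} → D y → ev x ⊑ ev y → D x
  ⊑⇒D dy (inj₁ refl) = dy
  ⊑⇒D dy (inj₂ x⊏y)  = ⊏⇒D x⊏y

  shared-input⇒# : ∀ {b v₁ v₂ x y} → v₁ ≢ v₂ → cd b ⟶ ev v₁ → cd b ⟶ ev v₂ →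
                   ev v₁ ⊑ ev x → ev v₂ ⊑ ev y → _#_ A P (ev x) (ev y)
  shared-input⇒# v₁≢v₂ b→v₁ b→v₂ v₁⊑x v₂⊑y =
    _ , _ , _ , (λ ()) , (λ ()) , v₁≢v₂ , b→v₁ , b→v₂ , ⊑⇒⋆ v₁⊑x , ⊑⇒⋆ v₂⊑y

  ¬¬-crossing : ∀ (Q : ℕ → Set) {x y} → Q x → ¬ Q y → ev x ⊏ ev y →
                ¬ ¬ ∃₂ λ z z' → ∃ λ c → ev x ⊑ ev z × ev z ⟶ cd c × cd c ⟶ ev z' × ev z' ⊑ ev y × Q z × ¬ Q z'
  ¬¬-crossing Q qx ¬qy [ () ]
  ¬¬-crossing Q qx ¬qy (x→c@(post-arc _ _) ∷ [ c→y@(pre-arc _ _) ]) k =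
    k (_ , _ , _ , inj₁ refl , x→c , c→y , inj₁ refl , qx , ¬qy)
  ¬¬-crossing Q qx ¬qy (x→c@(post-arc _ _) ∷ c→z@(pre-arc _ _) ∷ z⊏y) k = ¬¬-excluded-middle λ where
    (yes qz)  → ¬¬-crossing Q qz ¬qy z⊏y λ (u , u' , d , z⊑u , rest) →
                  k (u , u' , d , inj₂ (⊏-via x→c c→z z⊑u) , rest)
    (no ¬qz) → k (_ , _ , _ , inj₁ refl , x→c , c→z , inj₂ z⊏y , qx , ¬qz)

  After-++ : ∀ α β M → after (α ++ β) M ≡ after β (after α M)
  After-++ []      β M = refl
  After-++ (k ∷ α) β M = After-++ α β (fire A P k M)

  Fires-++⁻ : ∀ α {β M} → Fires (α ++ β) M → Fires α M × Fires β (after α M)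
  Fires-++⁻ []      f                   = tt , f
  Fires-++⁻ (k ∷ α) (dk , enabled , f) = Product.map₁ (λ fα → dk , enabled , fα) (Fires-++⁻ α f)

  Fires-++⁺ : ∀ α {β M} → Fires α M → Fires β (after α M) → Fires (α ++ β) M
  Fires-++⁺ []      _                     fβ = fβ
  Fires-++⁺ (k ∷ α) (dk , enabled , fα) fβ = dk , enabled , Fires-++⁺ α fα fβ

  Fires⇒D : ∀ {σ M k} → Fires σ M → k ∈ σ → D k
  Fires⇒D (dk , _ , _) (here refl)  = dk
  Fires⇒D (_ , _ , f)  (there k∈σ) = Fires⇒D f k∈σ

  Fires-from-prefixes : ∀ β {M} → (∀ γ {k δ} → β ≡ γ ++ k ∷ δ → D k × (∀ b → Pre b k → after γ M b)) →
                        Fires β M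
  Fires-from-prefixes []      enabled = tt
  Fires-from-prefixes (k ∷ β) enabled =
    proj₁ (enabled [] refl) , proj₂ (enabled [] refl) ,
    Fires-from-prefixes β λ γ β≡ → enabled (k ∷ γ) (cong (k ∷_) β≡)

  after⁻ : ∀ σ {M b} → after σ M b → M b ⊎ ∃ λ p → p ∈ σ × Post b p
  after⁻ []      marked = inj₁ marked
  after⁻ (k ∷ σ) marked with after⁻ σ marked
  ... | inj₁ (inj₁ (m , _))    = inj₁ m
  ... | inj₁ (inj₂ b∈k•)       = inj₂ (k , here refl , b∈k•)
  ... | inj₂ (p , p∈σ , b∈p•) = inj₂ (p , there p∈σ , b∈p•)

  after⁺ : ∀ σ {M b} → M b ⊎ (∃ λ p → p ∈ σ × Post b p) → (∀ w → w ∈ σ → ¬ Pre b w) → after σ M b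
  after⁺ []      (inj₁ m) _ = m
  after⁺ (k ∷ σ) {M} {b} source unconsumed = after⁺ σ (step source) (λ w → unconsumed w ∘ there)
    where
    step : M b ⊎ (∃ λ p → p ∈ k ∷ σ × Post b p) → fire A P k M b ⊎ ∃ λ p → p ∈ σ × Post b p
    step (inj₁ m)                     = inj₁ (inj₁ (m , unconsumed k (here refl)))
    step (inj₂ (_ , here refl , b∈k•)) = inj₁ (inj₂ b∈k•)
    step (inj₂ (p , there p∈σ , b∈p•)) = inj₂ (p , p∈σ , b∈p•)

  input-source : ∀ {k b} → D k → Pre b k → M⁰ b ⊎ ∃ λ y → Post b y × y < k
  input-source dk b∈•k with pre-reach dk
  ... | σ , σ<k , _ , enabled with after⁻ σ (enabled _ b∈•k)
  ... | inj₁ initial           = inj₁ initial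
  ... | inj₂ (y , y∈σ , b∈y•) = inj₂ (y , b∈y• , All.lookup σ<k y∈σ)

  input-producer< : ∀ {k j p} → D k → Pre (j , just p) k → p < k
  input-producer< dk b∈•k with input-source dk b∈•k
  ... | inj₁ ()
  ... | inj₂ (_ , (_ , refl) , p<k) = p<k

  ⊏⇒< : ∀ {x y} → ev x ⊏ ev y → x < y
  ⊏⇒< [ () ]
  ⊏⇒< (post-arc _ (_ , refl) ∷ [ pre-arc dy b∈•y ])        = input-producer< dy b∈•y
  ⊏⇒< (post-arc _ (_ , refl) ∷ pre-arc dz b∈•z ∷ z⊏y) = <-trans (input-producer< dz b∈•z) (⊏⇒< z⊏y)

  ⊏-irrefl : ∀ {x} → ¬ ev x ⊏ ev x
  ⊏-irrefl = <-irrefl refl ∘ ⊏⇒<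

  ⊑⇒≤ : ∀ {x y} → ev x ⊑ ev y → x ≤ y
  ⊑⇒≤ (inj₁ refl) = ≤-refl
  ⊑⇒≤ (inj₂ x⊏y)  = <⇒≤ (⊏⇒< x⊏y)

  has-participant : ∀ {k} → D k → ¬ (∀ j → ¬ Participates A (lab k) j)
  has-participant {k} dk none = proj₁ (lab-glob dk) idle
    where
    idle : ∀ j → lab k j ≡ nothing
    idle j with lab k j in eq
    ... | nothing = refl
    ... | just t  = ⊥-elim (none j (t , eq))

  fire-removes-input : ∀ {k M b} → D k → Pre b k → ¬ fire A P k M b
  fire-removes-input _ b∈•k (inj₁ (_ , b∉•k)) = b∉•k b∈•k
  fire-removes-input {b = _ , _} dk b∈•k (inj₂ (_ , refl)) = <-irrefl refl (input-producer< dk b∈•k)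

  reproduced-input : ∀ α β {k j} → D k → Participates A (lab k) j →
                     after α M⁰ (j , pre k j) → after β (fire A P k (after α M⁰)) (j , pre k j) →
                     ∃ λ q → q < k × q ∈ α × q ∈ β
  reproduced-input α β dk pj before again with after⁻ β again | after⁻ α {M⁰} before
  ... | inj₁ unconsumed | _ = ⊥-elim (fire-removes-input {M = after α M⁰} dk (pj , refl) unconsumed)
  ... | inj₂ (_ , _ , _ , produced) | inj₁ initial = case trans (sym initial) produced of λ ()
  ... | inj₂ (q , q∈β , _ , produced) | inj₂ (q' , q'∈α , _ , produced') =
    q , input-producer< dk (pj , produced) ,
    subst (_∈ α) (just-injective (trans (sym produced') produced)) q'∈α , q∈β

  refiring⇒earlier-refiring : ∀ α β {γ k} → Fires (α ++ k ∷ β ++ k ∷ γ) M⁰ →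
                              ¬ ¬ ∃ λ q → q < k × q ∈ α × q ∈ β
  refiring⇒earlier-refiring α β f with Fires-++⁻ α f
  ... | _ , dk , before , f′ with Fires-++⁻ β f′
  ... | _ , _ , again , _ = λ k′ → has-participant dk λ j pj →
    k′ (reproduced-input α β dk pj (before _ (pj , refl)) (again _ (pj , refl)))

  -- Both firings of p consume the same input conditions, which must therefore be produced twice,
  -- by events smaller than p.
  no-refiring : ∀ {p} → Acc _<_ p → ∀ α {β} → Fires (α ++ β) M⁰ → p ∈ α → p ∉ β
  no-refiring {p} (acc rec) α f p∈α p∈β with ∈-∃++ p∈α | ∈-∃++ p∈β
  ... | α₁ , α₂ , refl | β₁ , β₂ , refl =
    refired (α₂ ++ β₁) (subst (λ σ → Fires σ M⁰) (regroup α₁ α₂ β₁ β₂) f)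
    where
    refired : ∀ γ → ¬ Fires (α₁ ++ p ∷ γ ++ p ∷ β₂) M⁰
    refired γ f′ = refiring⇒earlier-refiring α₁ γ f′ λ (q , q<p , q∈α₁ , q∈γ) →
      no-refiring (rec q<p) α₁ f′ q∈α₁ (there (∈-++⁺ˡ q∈γ))

  consumed-unmarked : ∀ {σ k b} → Fires σ M⁰ → k ∈ σ → Pre b k → ¬ after σ M⁰ b
  consumed-unmarked {b = j , _} f k∈σ b∈•k marked with ∈-∃++ k∈σ
  ... | α , β , refl with Fires-++⁻ α f
  ... | _ , dk , before , _ with after⁻ β (subst (λ M → M _) (After-++ α _ M⁰) marked)
  ... | inj₁ unconsumed = fire-removes-input {M = after α M⁰} dk b∈•k unconsumed
  ... | inj₂ (p , p∈β , _ , refl) with after⁻ α {M⁰} (before _ b∈•k)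
  ...   | inj₁ ()
  ...   | inj₂ (_ , p∈α , _ , refl) = no-refiring (<-wellFounded p) α f p∈α (there p∈β)

  consumed-before : ∀ α {β k k' b} → Fires (α ++ k ∷ β) M⁰ → k' ∈ α → Pre b k' → ¬ Pre b k
  consumed-before α f k'∈α b∈•k' b∈•k with Fires-++⁻ α f
  ... | fα , _ , before , _ = consumed-unmarked fα k'∈α b∈•k' (before _ b∈•k)

  consumer-unique : ∀ {σ k k' b} → Fires σ M⁰ → k ∈ σ → k' ∈ σ → k ≢ k' → Pre b k → Pre b k' → ⊥
  consumer-unique f k∈σ k'∈σ k≢k' b∈•k b∈•k' with ∈-∃++ k∈σ
  ... | α , β , refl with ∈-++⁻ α k'∈σ
  ... | inj₁ k'∈α         = consumed-before α f k'∈α b∈•k' b∈•k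
  ... | inj₂ (here refl)  = k≢k' refl
  ... | inj₂ (there k'∈β) with ∈-∃++ k'∈β
  ... | γ , δ , refl =
    consumed-before (α ++ _ ∷ γ) (subst (λ σ → Fires σ M⁰) (sym (++-assoc α _ _)) f)
      (∈-++⁺ʳ α (here refl)) b∈•k b∈•k'

  input-producer∈ : ∀ {σ z j x} → Fires σ M⁰ → z ∈ σ → Pre (j , just x) z → x ∈ σ
  input-producer∈ f z∈σ b∈•z with ∈-∃++ z∈σ
  ... | α , β , refl with Fires-++⁻ α f
  ... | _ , _ , before , _ with after⁻ α {M⁰} (before _ b∈•z)
  ... | inj₁ ()
  ... | inj₂ (_ , x∈α , _ , refl) = ∈-++⁺ˡ x∈α

  Fires-past-closed : ∀ {σ x y} → Fires σ M⁰ → y ∈ σ → ev x ⊏ ev y → x ∈ σ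
  Fires-past-closed f y∈σ [ () ]
  Fires-past-closed f y∈σ (post-arc _ (_ , refl) ∷ [ pre-arc _ b∈•y ]) = input-producer∈ f y∈σ b∈•y
  Fires-past-closed f y∈σ (post-arc _ (_ , refl) ∷ pre-arc _ b∈•z ∷ z⊏y) =
    input-producer∈ f (Fires-past-closed f y∈σ z⊏y) b∈•z

  -- Sorting by index is a topological order, as every producer precedes its consumers;
  -- ρ serves to show that two events of τ never consume the same condition.
  sorted-past-closed⇒Fires : ∀ {ρ τ} → Fires ρ M⁰ → (∀ {x} → x ∈ τ → x ∈ ρ) → AllPairs _<_ τ →
                             (∀ {y k} → k ∈ τ → ev y ⊏ ev k → y ∈ τ) → Fires τ M⁰
  sorted-past-closed⇒Fires {τ = τ} fρ τ⊆ρ sorted closed = Fires-from-prefixes τ enabled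
    where
    enabled : ∀ γ {k δ} → τ ≡ γ ++ k ∷ δ → D k × (∀ b → Pre b k → after γ M⁰ b)
    enabled γ {k} {δ} τ≡ = dk , λ b b∈•k → after⁺ γ (source b∈•k) (unconsumed b∈•k)
      where
      in-τ : ∀ {x} → x ∈ γ ++ k ∷ δ → x ∈ τ
      in-τ = subst (_ ∈_) (sym τ≡)
      sorted′ : AllPairs _<_ (γ ++ k ∷ δ)
      sorted′ = subst (AllPairs _<_) τ≡ sorted
      k∈τ : k ∈ τ
      k∈τ = in-τ (∈-++⁺ʳ γ (here refl))
      dk : D k
      dk = Fires⇒D fρ (τ⊆ρ k∈τ)
      source : ∀ {b} → Pre b k → M⁰ b ⊎ ∃ λ y → y ∈ γ × Post b y
      source b∈•k with input-source dk b∈•k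
      ... | inj₁ initial = inj₁ initial
      ... | inj₂ (y , b∈y• , y<k) = inj₂ (y , sorted-below γ sorted′ (subst (y ∈_) τ≡ y∈τ) y<k , b∈y•)
        where
        y∈τ : y ∈ τ
        y∈τ = closed k∈τ (post-arc (D-closed y<k dk) b∈y• ∷ [ pre-arc dk b∈•k ])
      unconsumed : ∀ {b} → Pre b k → ∀ w → w ∈ γ → ¬ Pre b w
      unconsumed b∈•k w w∈γ = consumer-unique fρ (τ⊆ρ k∈τ) (τ⊆ρ (in-τ (∈-++⁺ˡ w∈γ)))
        (<⇒≢ (sorted-before γ sorted′ w∈γ) ∘ sym) b∈•k

  PastSequence : ℕ → List ℕ → Set
  PastSequence e σ = Fires σ M⁰ × (∀ x → (x ∈ σ → ev x ⊑ ev e) × (ev x ⊑ ev e → x ∈ σ))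

  ¬¬-past-sequence : ∀ {e} → D e → ¬ ¬ ∃ (PastSequence e)
  ¬¬-past-sequence {e} de with pre-reach de
  ... | σ₀ , _ , f₀ , e-enabled = ¬¬-enumeration (λ x → ev x ⊑ ev e) (suc e) ∘ (_∘ past-sequence)
    where
    ρ : List ℕ
    ρ = σ₀ ++ e ∷ []
    e∈ρ : e ∈ ρ
    e∈ρ = ∈-++⁺ʳ σ₀ (here refl)
    fρ : Fires ρ M⁰
    fρ = Fires-++⁺ σ₀ f₀ (de , e-enabled , tt)
    past⊆ρ : ∀ {x} → ev x ⊑ ev e → x ∈ ρ
    past⊆ρ (inj₁ refl) = e∈ρ
    past⊆ρ (inj₂ x⊏e)  = Fires-past-closed fρ e∈ρ x⊏e
    past-sequence : ∃ (Enumerates (λ x → ev x ⊑ ev e) (suc e)) → ∃ (PastSequence e)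
    past-sequence (τ , sorted , sound , complete) = τ , fτ , λ x → proj₂ ∘ sound , past⊆τ
      where
      past⊆τ : ∀ {x} → ev x ⊑ ev e → x ∈ τ
      past⊆τ x⊑e = complete (s≤s (⊑⇒≤ x⊑e)) x⊑e
      fτ : Fires τ M⁰
      fτ = sorted-past-closed⇒Fires fρ (past⊆ρ ∘ proj₂ ∘ sound) sorted
             λ k∈τ y⊏k → past⊆τ (⊑-trans (inj₂ y⊏k) (proj₂ (sound k∈τ)))

  ¬¬-InMark : ∀ {e b p} → D e → ev p ⊑ ev e → Post b p → (∀ v → ev v ⊑ ev e → ¬ Pre b v) →
              ¬ ¬ InMark A P e b
  ¬¬-InMark de p⊑e b∈p• unconsumed k = ¬¬-past-sequence de λ (σ , f , past) →
    k (σ , f , past , after⁺ σ (inj₂ (_ , proj₂ (past _) p⊑e , b∈p•))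
                                λ v v∈σ → unconsumed v (proj₁ (past v) v∈σ))

  InMark⇒producer-in-past : ∀ {e b p} → InMark A P e b → Post b p → ev p ⊑ ev e
  InMark⇒producer-in-past {b = _ , _} (σ , _ , past , marked) (_ , refl) with after⁻ σ {M⁰} marked
  ... | inj₁ ()
  ... | inj₂ (_ , p∈σ , _ , refl) = proj₁ (past _) p∈σ

  InMark⇒unconsumed : ∀ {e b w} → InMark A P e b → ev w ⊑ ev e → ¬ Pre b w
  InMark⇒unconsumed (σ , f , past , marked) w⊑e b∈•w = consumed-unmarked f (proj₂ (past _) w⊑e) b∈•w marked

  no-exit : ∀ {e e' ê z c z'} → D e → D e' → StrongCause A P e' e →
            Concurrent A P (ev ê) (ev e') → Concurrent A P (ev ê) (ev e) →
            ev z ⟶ cd c → cd c ⟶ ev z' →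
            ev z ⊑ ev e → ¬ ev z ⊑ ev e' → ¬ ev z' ⊑ ev e → ev z' ⊑ ev ê → ⊥
  no-exit {e} {e'} {c = c} {z'} de de' (e'⊏e , strong) ê∥e' ê∥e
          (post-arc _ c∈z•) c→z' z⊑e z⋢e' z'⋢e z'⊑ê with ⊏-uncons e'⊏e
  ... | d , w , e'→d@(post-arc _ d∈e'•) , pre-arc _ d∈•w , w⊑e =
    ¬¬-InMark de z⊑e c∈z• c-unconsumed λ c∈M[e] →
    ¬¬-InMark de' (inj₁ refl) d∈e'• d-unconsumed λ d∈M[e'] →
    let d⊏c = strong c d c∈M[e] (λ c∈M[e'] → z⋢e' (InMark⇒producer-in-past c∈M[e'] c∈z•))
                            d∈M[e'] (λ d∈M[e] → InMark⇒unconsumed d∈M[e] w⊑e d∈•w)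
    in proj₁ (proj₂ ê∥e') (inj₂ (e'→d ∷ d⊏c ++⁺ ⊏-◅ c→z' (⊑⇒⋆ z'⊑ê)))
    where
    c-unconsumed : ∀ v → ev v ⊑ ev e → ¬ Pre c v
    c-unconsumed v v⊑e c∈•v with z' ≟ v
    ... | yes refl  = z'⋢e v⊑e
    ... | no z'≢v = proj₂ (proj₂ ê∥e) (shared-input⇒# z'≢v c→z' (pre-arc (⊑⇒D de v⊑e) c∈•v) z'⊑ê v⊑e)
    d-unconsumed : ∀ v → ev v ⊑ ev e' → ¬ Pre d v
    d-unconsumed v v⊑e' d∈•v = ⊏-irrefl (⊏-via e'→d (pre-arc (⊑⇒D de' v⊑e') d∈•v) v⊑e')

lemma2 : ∀ {Act : Set} {n : ℕ} (A : Fin n → LTS Act) (P : PreBP A) →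
    IsBranchingProcess A P →
    ∀ e e' ê → PreBP.D P e → PreBP.D P e' → PreBP.D P ê →
    StrongCause A P e' e →
    Concurrent A P (ev ê) (ev e') → Concurrent A P (ev ê) (ev e) →
    ∀ x → ¬ (_≼_ A P (ev x) (ev e) × ¬ _≼_ A P (ev x) (ev e') × _≼_ A P (ev x) (ev ê))
lemma2 A P BP e e' ê de de' _ e'≪e ê∥e' ê∥e x (x⊑e , x⋢e' , x⊑ê) = case x⊑ê of λ where
    (inj₁ refl) → proj₁ ê∥e x⊑e
    (inj₂ x⊏ê)  → ¬¬-crossing (λ y → ev y ⊑ ev e) x⊑e (proj₁ ê∥e) x⊏ê
      λ (z , z' , c , x⊑z , z→c , c→z' , z'⊑ê , z⊑e , z'⋢e) →
        no-exit de de' e'≪e ê∥e' ê∥e z→c c→z' z⊑e (x⋢e' ∘ ⊑-trans x⊑z) z'⋢e z'⊑ê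
  where open BranchingProcess A P BP
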